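{- Let $p/q>1$ be rational with positive continued fraction expansion $[a_1,\dots,a_{2m}]$ and negative continued fraction expansion $[[c_1,\dots,c_k]]$. Then \[ M^+(a_1,\dots,a_{2m})=M(c_1,\dots,c_k)\begin{pmatrix}1&1\\0&1\end{pmatrix}. \]
   Context: $[a_1,\dots,a_r]=a_1+1/(a_2+1/(\cdots+1/a_r))$; every rational $p/q>1$ has a unique expansion $[a_1,\dots,a_{2m}]$ with positive integer terms and an even number of terms (positive expansion). $[[c_1,\dots,c_k]]=c_1-1/(c_2-1/(\cdots-1/c_k))$; every rational $p/q>1$ has a unique such expansion with all $c_i\ge 2$ integers (negative expansion). $M^+(a_1,\dots,a_r)=\prod_{i=1}^r\begin{pmatrix}a_i&1\\1&0\end{pmatrix}$ and $M(c_1,\dots,c_k)=\prod_{i=1}^k\begin{pmatrix}c_i&-1\\1&0\end{pmatrix}$ (products in the order $i=1,2,\dots$ from left to right). -}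

module Defs where

open import Data.Nat using (ℕ)
open import Data.Integer using (ℤ; +_; _+_; _*_; -_)
open import Data.List using (List; []; _∷_; foldr)
import Data.Rational as ℚ
open ℚ using (ℚ; NonZero; 1/_)

record Mat2 : Set where
  constructor mat
  field
    m11 m12 m21 m22 : ℤ

infixl 7 _⊗_
_⊗_ : Mat2 → Mat2 → Mat2
mat a b c d ⊗ mat e f g h = mat (a * e + b * g) (a * f + b * h) (c * e + d * g) (c * f + d * h)

I₂ : Mat2
I₂ = mat (+ 1) (+ 0) (+ 0) (+ 1)

T : Mat2
T = mat (+ 1) (+ 1) (+ 0) (+ 1)

M⁺ : List ℕ → Mat2
M⁺ = foldr (λ a P → mat (+ a) (+ 1) (+ 1) (+ 0) ⊗ P) I₂

M⁻ : List ℕ → Mat2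
M⁻ = foldr (λ c P → mat (+ c) (- (+ 1)) (+ 1) (+ 0) ⊗ P) I₂

ℕ→ℚ : ℕ → ℚ
ℕ→ℚ n = + n ℚ./ 1

-- PosCF as x :  [a₁,…,a_r] = a₁ + 1/(a₂ + 1/(⋯ + 1/a_r)) = x   (r ≥ 1;
-- each inner value is required to be nonzero so that 1/_ makes sense)
data PosCF : List ℕ → ℚ → Set where
  one  : (a : ℕ) → PosCF (a ∷ []) (ℕ→ℚ a)
  cons : (a : ℕ) {as : List ℕ} {y : ℚ} → PosCF as y → (nz : NonZero y) →
         PosCF (a ∷ as) (ℕ→ℚ a ℚ.+ (1/_ y {{nz}}))

data NegCF : List ℕ → ℚ → Set where
  one  : (c : ℕ) → NegCF (c ∷ []) (ℕ→ℚ c)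
  cons : (c : ℕ) {cs : List ℕ} {y : ℚ} → NegCF cs y → (nz : NonZero y) →
         NegCF (c ∷ cs) (ℕ→ℚ c ℚ.- (1/_ y {{nz}}))

-- Both M⁺(a₁,…,a₂ₘ) and M(c₁,…,c_k) T are matrices ( p b ; q d ) with natural entries,
-- determinant 1, x q = p and 1 ≤ d ≤ q, and there is only one such matrix: determinant 1
-- makes p / q a reduced fraction, so x fixes p and q; then p d ≡ 1 (mod q) with 1 ≤ d ≤ q
-- fixes d, and b follows.  For M⁺ the determinant is (−1)²ᵐ and the bounds come from
-- aᵢ ≥ 1; for M(c₁,…,c_k) T the conditions cᵢ ≥ 2 keep the entries natural and ordered.
module Submission where

open import Defs
open import Data.Nat using (ℕ; _≤_; _*_)
open import Data.List using (List; length)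
open import Data.List.Relation.Unary.All using (All)
open import Data.Rational using (ℚ; 1ℚ; _<_)
open import Relation.Binary.PropositionalEquality using (_≡_)

open import Data.Nat as ℕ using (zero; suc; _+_; _∸_; z≤n; s≤s; NonZero)
import Data.Nat.Properties as ℕ
open import Data.Nat.Divisibility using (_∣_; divides; ∣-antisym; >⇒∤)
open import Data.Nat.Coprimality using (Coprime; Bézout-coprime; coprime-divisor)
open import Data.Nat.GCD using (module Bézout)
import Data.Nat.Tactic.RingSolver as ℕ-Solver
open import Data.Integer as ℤ using (ℤ; +_; 1ℤ)
import Data.Integer.Properties as ℤ
import Data.Integer.Tactic.RingSolver as ℤ-Solver
import Data.Rational as ℚ
import Data.Rational.Properties as ℚ
open import Data.Rational.Unnormalised as ℚᵘ using (mkℚᵘ; *≡*)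
import Data.Rational.Unnormalised.Properties as ℚᵘ
open import Data.List using ([]; _∷_)
open import Data.List.Relation.Unary.All using ([]; _∷_)
open import Data.Product using (_×_; _,_)
open import Data.Empty using (⊥-elim)
open import Relation.Binary.PropositionalEquality
  using (refl; sym; trans; cong; cong₂; subst₂; module ≡-Reasoning)

ι : ℕ → ℚ
ι = ℕ→ℚ

toℚᵘ-ι : ∀ n → ℚ.toℚᵘ (ι n) ℚᵘ.≃ mkℚᵘ (+ n) 0
toℚᵘ-ι n = ℚ.toℚᵘ-fromℚᵘ (mkℚᵘ (+ n) 0)

ι-+ : ∀ m n → ι (m + n) ≡ ι m ℚ.+ ι n
ι-+ m n = ℚ.toℚᵘ-injective (begin
  ℚ.toℚᵘ (ι (m + n))                 ≈⟨ toℚᵘ-ι (m + n) ⟩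
  mkℚᵘ (+ (m + n)) 0                 ≈⟨ *≡* (cong (ℤ._* + 1) (cong₂ ℤ._+_ (m≡m*1 m) (m≡m*1 n))) ⟩
  mkℚᵘ (+ m) 0 ℚᵘ.+ mkℚᵘ (+ n) 0     ≈⟨ ℚᵘ.≃-sym (ℚᵘ.+-cong (toℚᵘ-ι m) (toℚᵘ-ι n)) ⟩
  ℚ.toℚᵘ (ι m) ℚᵘ.+ ℚ.toℚᵘ (ι n)     ≈⟨ ℚᵘ.≃-sym (ℚ.toℚᵘ-homo-+ (ι m) (ι n)) ⟩
  ℚ.toℚᵘ (ι m ℚ.+ ι n)               ∎)
  where
  open ℚᵘ.≃-Reasoning
  m≡m*1 : ∀ m → + m ≡ + m ℤ.* + 1
  m≡m*1 m = sym (ℤ.*-identityʳ (+ m))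

ι-* : ∀ m n → ι (m * n) ≡ ι m ℚ.* ι n
ι-* m n = ℚ.toℚᵘ-injective (begin
  ℚ.toℚᵘ (ι (m * n))                 ≈⟨ toℚᵘ-ι (m * n) ⟩
  mkℚᵘ (+ (m * n)) 0                 ≈⟨ *≡* (cong (ℤ._* + 1) (ℤ.pos-* m n)) ⟩
  mkℚᵘ (+ m) 0 ℚᵘ.* mkℚᵘ (+ n) 0     ≈⟨ ℚᵘ.≃-sym (ℚᵘ.*-cong (toℚᵘ-ι m) (toℚᵘ-ι n)) ⟩
  ℚ.toℚᵘ (ι m) ℚᵘ.* ℚ.toℚᵘ (ι n)     ≈⟨ ℚᵘ.≃-sym (ℚ.toℚᵘ-homo-* (ι m) (ι n)) ⟩
  ℚ.toℚᵘ (ι m ℚ.* ι n)               ∎)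
  where open ℚᵘ.≃-Reasoning

ι-injective : ∀ {m n} → ι m ≡ ι n → m ≡ n
ι-injective {m} {n} eq with ℚᵘ.≃-trans (ℚᵘ.≃-sym (toℚᵘ-ι m))
                              (ℚᵘ.≃-trans (ℚᵘ.≃-reflexive (cong ℚ.toℚᵘ eq)) (toℚᵘ-ι n))
... | *≡* m*1≡n*1 = ℤ.+-injective (begin
  + m         ≡⟨ sym (ℤ.*-identityʳ (+ m)) ⟩
  + m ℤ.* + 1 ≡⟨ m*1≡n*1 ⟩
  + n ℤ.* + 1 ≡⟨ ℤ.*-identityʳ (+ n) ⟩
  + n         ∎)
  where open ≡-Reasoning

slope-cross : ∀ x {p q p′ q′} → x ℚ.* ι q ≡ ι p → x ℚ.* ι q′ ≡ ι p′ → p * q′ ≡ p′ * q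
slope-cross x {p} {q} {p′} {q′} xq≡p xq′≡p′ = ι-injective (begin
  ι (p * q′)                ≡⟨ ι-* p q′ ⟩
  ι p ℚ.* ι q′              ≡⟨ cong (ℚ._* ι q′) (sym xq≡p) ⟩
  x ℚ.* ι q ℚ.* ι q′        ≡⟨ ℚ.*-assoc x (ι q) (ι q′) ⟩
  x ℚ.* (ι q ℚ.* ι q′)      ≡⟨ cong (x ℚ.*_) (ℚ.*-comm (ι q) (ι q′)) ⟩
  x ℚ.* (ι q′ ℚ.* ι q)      ≡⟨ sym (ℚ.*-assoc x (ι q′) (ι q)) ⟩
  x ℚ.* ι q′ ℚ.* ι q        ≡⟨ cong (ℚ._* ι q) xq′≡p′ ⟩
  ι p′ ℚ.* ι q              ≡⟨ sym (ι-* p′ q) ⟩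
  ι (p′ * q)                ∎)
  where open ≡-Reasoning

module _ (y : ℚ) .{{_ : ℚ.NonZero y}} {p q : ℕ} (yq≡p : y ℚ.* ι q ≡ ι p) where
  open ≡-Reasoning

  1/y*p≡q : ℚ.1/ y ℚ.* ι p ≡ ι q
  1/y*p≡q = begin
    ℚ.1/ y ℚ.* ι p             ≡⟨ cong (ℚ.1/ y ℚ.*_) (sym yq≡p) ⟩
    ℚ.1/ y ℚ.* (y ℚ.* ι q)     ≡⟨ sym (ℚ.*-assoc (ℚ.1/ y) y (ι q)) ⟩
    ℚ.1/ y ℚ.* y ℚ.* ι q       ≡⟨ cong (ℚ._* ι q) (ℚ.*-inverseˡ y) ⟩
    1ℚ ℚ.* ι q                 ≡⟨ ℚ.*-identityˡ (ι q) ⟩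
    ι q                        ∎

  +1/-slope : ∀ a → (ι a ℚ.+ ℚ.1/ y) ℚ.* ι p ≡ ι (a * p + q)
  +1/-slope a = begin
    (ι a ℚ.+ ℚ.1/ y) ℚ.* ι p            ≡⟨ ℚ.*-distribʳ-+ (ι p) (ι a) (ℚ.1/ y) ⟩
    ι a ℚ.* ι p ℚ.+ ℚ.1/ y ℚ.* ι p      ≡⟨ cong₂ ℚ._+_ (sym (ι-* a p)) 1/y*p≡q ⟩
    ι (a * p) ℚ.+ ι q                   ≡⟨ sym (ι-+ (a * p) q) ⟩
    ι (a * p + q)                       ∎

  -1/-slope : ∀ c p′ → p′ + q ≡ c * p → (ι c ℚ.- ℚ.1/ y) ℚ.* ι p ≡ ι p′
  -1/-slope c p′ p′+q≡cp = begin
    (ι c ℚ.- ℚ.1/ y) ℚ.* ι p               ≡⟨ ℚ.*-distribʳ-+ (ι p) (ι c) (ℚ.- ℚ.1/ y) ⟩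
    ι c ℚ.* ι p ℚ.+ ℚ.- ℚ.1/ y ℚ.* ι p     ≡⟨ cong (ι c ℚ.* ι p ℚ.+_) (sym (ℚ.neg-distribˡ-* (ℚ.1/ y) (ι p))) ⟩
    ι c ℚ.* ι p ℚ.- ℚ.1/ y ℚ.* ι p         ≡⟨ cong₂ ℚ._-_ (sym (ι-* c p)) 1/y*p≡q ⟩
    ι (c * p) ℚ.- ι q                      ≡⟨ cong (λ n → ι n ℚ.- ι q) (sym p′+q≡cp) ⟩
    ι (p′ + q) ℚ.- ι q                     ≡⟨ cong (ℚ._- ι q) (ι-+ p′ q) ⟩
    ι p′ ℚ.+ ι q ℚ.- ι q                   ≡⟨ ℚ.+-assoc (ι p′) (ι q) (ℚ.- ι q) ⟩
    ι p′ ℚ.+ (ι q ℚ.- ι q)                 ≡⟨ cong (ι p′ ℚ.+_) (ℚ.+-inverseʳ (ι q)) ⟩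
    ι p′ ℚ.+ ℚ.0ℚ                          ≡⟨ ℚ.+-identityʳ (ι p′) ⟩
    ι p′                                   ∎

mat-≡ : ∀ {a b c d a′ b′ c′ d′} → a ≡ a′ → b ≡ b′ → c ≡ c′ → d ≡ d′ →
        mat a b c d ≡ mat a′ b′ c′ d′
mat-≡ refl refl refl refl = refl

⊗-assoc : ∀ A B C → (A ⊗ B) ⊗ C ≡ A ⊗ (B ⊗ C)
⊗-assoc (mat a b c d) (mat e f g h) (mat i j k l) =
  mat-≡ (entry a b e f g h i k) (entry a b e f g h j l)
        (entry c d e f g h i k) (entry c d e f g h j l)
  where
  entry : ∀ a b e f g h i k →
          (a ℤ.* e ℤ.+ b ℤ.* g) ℤ.* i ℤ.+ (a ℤ.* f ℤ.+ b ℤ.* h) ℤ.* k ≡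
          a ℤ.* (e ℤ.* i ℤ.+ f ℤ.* k) ℤ.+ b ℤ.* (g ℤ.* i ℤ.+ h ℤ.* k)
  entry = ℤ-Solver.solve-∀

det : Mat2 → ℤ
det (mat a b c d) = a ℤ.* d ℤ.- b ℤ.* c

det-⊗ : ∀ A B → det (A ⊗ B) ≡ det A ℤ.* det B
det-⊗ (mat a b c d) (mat e f g h) = identity a b c d e f g h
  where
  identity : ∀ a b c d e f g h →
    (a ℤ.* e ℤ.+ b ℤ.* g) ℤ.* (c ℤ.* f ℤ.+ d ℤ.* h) ℤ.- (a ℤ.* f ℤ.+ b ℤ.* h) ℤ.* (c ℤ.* e ℤ.+ d ℤ.* g)
    ≡ (a ℤ.* d ℤ.- b ℤ.* c) ℤ.* (e ℤ.* h ℤ.- f ℤ.* g)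
  identity = ℤ-Solver.solve-∀

A⁺ A⁻ : ℕ → Mat2
A⁺ a = mat (+ a) (+ 1) (+ 1) (+ 0)
A⁻ c = mat (+ c) (ℤ.- + 1) (+ 1) (+ 0)

unit-row : ∀ x y → + 1 ℤ.* x ℤ.+ + 0 ℤ.* y ≡ x
unit-row = ℤ-Solver.solve-∀

det-M⁺ : ∀ as → det (M⁺ as) ≡ (ℤ.- 1ℤ) ℤ.^ length as
det-M⁺ []       = refl
det-M⁺ (a ∷ as) = begin
  det (A⁺ a ⊗ M⁺ as)          ≡⟨ det-⊗ (A⁺ a) (M⁺ as) ⟩
  det (A⁺ a) ℤ.* det (M⁺ as)  ≡⟨ cong₂ ℤ._*_ (det-A⁺ (+ a)) (det-M⁺ as) ⟩
  ℤ.- 1ℤ ℤ.* (ℤ.- 1ℤ) ℤ.^ length as ∎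
  where
  open ≡-Reasoning
  det-A⁺ : ∀ a → a ℤ.* + 0 ℤ.- + 1 ℤ.* + 1 ≡ ℤ.- 1ℤ
  det-A⁺ = ℤ-Solver.solve-∀

det-M⁻ : ∀ cs → det (M⁻ cs) ≡ 1ℤ
det-M⁻ []       = refl
det-M⁻ (c ∷ cs) = begin
  det (A⁻ c ⊗ M⁻ cs)          ≡⟨ det-⊗ (A⁻ c) (M⁻ cs) ⟩
  det (A⁻ c) ℤ.* det (M⁻ cs)  ≡⟨ cong₂ ℤ._*_ (det-A⁻ (+ c)) (det-M⁻ cs) ⟩
  1ℤ                          ∎
  where
  open ≡-Reasoning
  det-A⁻ : ∀ c → c ℤ.* + 0 ℤ.- ℤ.- + 1 ℤ.* + 1 ≡ 1ℤ
  det-A⁻ = ℤ-Solver.solve-∀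

-- Normal forms

record NatMat : Set where
  constructor natMat
  field p b q d : ℕ

toMat2 : NatMat → Mat2
toMat2 (natMat p b q d) = mat (+ p) (+ b) (+ q) (+ d)

det-toMat2≡1 : ∀ X → det (toMat2 X) ≡ 1ℤ → let open NatMat X in p * d ≡ 1 + b * q
det-toMat2≡1 (natMat p b q d) det≡1 = ℤ.+-injective (begin
  + (p * d)                                      ≡⟨ ℤ.pos-* p d ⟩
  + p ℤ.* + d                                    ≡⟨ sub-add (+ p ℤ.* + d) (+ b ℤ.* + q) ⟩
  (+ p ℤ.* + d ℤ.- + b ℤ.* + q) ℤ.+ + b ℤ.* + q  ≡⟨ cong₂ ℤ._+_ det≡1 (sym (ℤ.pos-* b q)) ⟩
  + (1 + b * q)                                  ∎)
  where
  open ≡-Reasoning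
  sub-add : ∀ m n → m ≡ (m ℤ.- n) ℤ.+ n
  sub-add = ℤ-Solver.solve-∀

record IsNormalForm (x : ℚ) (X : NatMat) : Set where
  open NatMat X
  field
    det≡1 : p * d ≡ 1 + b * q
    1≤d   : 1 ≤ d
    d≤q   : d ≤ q
    slope : x ℚ.* ι q ≡ ι p

det≡1⇒coprime : ∀ p b q d → p * d ≡ 1 + b * q → Coprime q p
det≡1⇒coprime p b q d det≡1 = Bézout-coprime (Bézout.-+ b d (begin
  1 + b * (q * 1)   ≡⟨ cong (λ n → 1 + b * n) (ℕ.*-identityʳ q) ⟩
  1 + b * q         ≡⟨ sym det≡1 ⟩
  p * d             ≡⟨ ℕ.*-comm p d ⟩
  d * p             ≡⟨ cong (d *_) (sym (ℕ.*-identityʳ p)) ⟩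
  d * (p * 1)       ∎))
  where open ≡-Reasoning

∣∧<⇒≡0 : ∀ {q n} → q ∣ n → n ℕ.< q → n ≡ 0
∣∧<⇒≡0 {n = zero}  _   _   = refl
∣∧<⇒≡0 {n = suc n} q∣n n<q = ⊥-elim (>⇒∤ n<q q∣n)

-- Both d and d′ are inverses of p modulo q, so q divides d′ ∸ d < q.
det≡1⇒d≤ : ∀ {p b q d b′ d′} → p * d ≡ 1 + b * q → p * d′ ≡ 1 + b′ * q →
           1 ≤ d → d ≤ q → d′ ≤ q → d′ ≤ d
det≡1⇒d≤ {p} {b} {q} {d} {b′} {d′} det≡1 det′≡1 1≤d d≤q d′≤q =
  ℕ.m∸n≡0⇒m≤n (∣∧<⇒≡0 q∣d′∸d d′∸d<q)
  where
  open ≡-Reasoning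
  q∣d′∸d : q ∣ d′ ∸ d
  q∣d′∸d = coprime-divisor (det≡1⇒coprime p b q d det≡1) (divides (b′ ∸ b) (begin
    p * (d′ ∸ d)               ≡⟨ ℕ.*-distribˡ-∸ p d′ d ⟩
    p * d′ ∸ p * d             ≡⟨ cong₂ _∸_ det′≡1 det≡1 ⟩
    (1 + b′ * q) ∸ (1 + b * q) ≡⟨ sym (ℕ.*-distribʳ-∸ q b′ b) ⟩
    (b′ ∸ b) * q               ∎))
  d′∸d<q : d′ ∸ d ℕ.< q
  d′∸d<q = ℕ.m<n+o⇒m∸n<o d′ d {{ℕ.>-nonZero (ℕ.≤-trans 1≤d d≤q)}}
             (ℕ.≤-<-trans d′≤q (ℕ.m<n+m q 1≤d))

normalForm-col₁ : ∀ {x p b q d p′ b′ q′ d′} →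
                  IsNormalForm x (natMat p b q d) → IsNormalForm x (natMat p′ b′ q′ d′) →
                  p ≡ p′ × q ≡ q′
normalForm-col₁ {x} {p} {b} {q} {d} {p′} {b′} {q′} {d′} X-nf Y-nf = p≡p′ , q≡q′
  where
  module X = IsNormalForm X-nf
  module Y = IsNormalForm Y-nf
  cross : p * q′ ≡ p′ * q
  cross = slope-cross x {p} {q} {p′} {q′} X.slope Y.slope
  q≡q′ : q ≡ q′
  q≡q′ = ∣-antisym (coprime-divisor (det≡1⇒coprime p b q d X.det≡1) (divides p′ cross))
                   (coprime-divisor (det≡1⇒coprime p′ b′ q′ d′ Y.det≡1) (divides p (sym cross)))
  p≡p′ : p ≡ p′
  p≡p′ = ℕ.*-cancelʳ-≡ p p′ q {{ℕ.>-nonZero (ℕ.≤-trans X.1≤d X.d≤q)}}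
           (trans (cong (p *_) q≡q′) cross)

normalForm-col₂ : ∀ {x p b q d b′ d′} →
                  IsNormalForm x (natMat p b q d) → IsNormalForm x (natMat p b′ q d′) →
                  b ≡ b′ × d ≡ d′
normalForm-col₂ {p = p} {b} {q} {d} {b′} {d′} X-nf Y-nf = b≡b′ , d≡d′
  where
  module X = IsNormalForm X-nf
  module Y = IsNormalForm Y-nf
  d≡d′ : d ≡ d′
  d≡d′ = ℕ.≤-antisym (det≡1⇒d≤ {p} {b′} {q} {d′} {b} {d} Y.det≡1 X.det≡1 Y.1≤d Y.d≤q X.d≤q)
                     (det≡1⇒d≤ {p} {b} {q} {d} {b′} {d′} X.det≡1 Y.det≡1 X.1≤d X.d≤q Y.d≤q)
  b≡b′ : b ≡ b′
  b≡b′ = ℕ.*-cancelʳ-≡ b b′ q {{ℕ.>-nonZero (ℕ.≤-trans X.1≤d X.d≤q)}}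
           (ℕ.suc-injective (trans (sym X.det≡1) (trans (cong (p *_) d≡d′) Y.det≡1)))

natMat-≡ : ∀ {p b q d p′ b′ q′ d′} → p ≡ p′ → b ≡ b′ → q ≡ q′ → d ≡ d′ →
           natMat p b q d ≡ natMat p′ b′ q′ d′
natMat-≡ refl refl refl refl = refl

normalForm-unique : ∀ {x X Y} → IsNormalForm x X → IsNormalForm x Y → X ≡ Y
normalForm-unique {x} {natMat _ _ _ _} {natMat _ b′ _ d′} X-nf Y-nf =
  let p≡p′ , q≡q′ = normalForm-col₁ X-nf Y-nf
      Y-nf′       = subst₂ (λ p q → IsNormalForm x (natMat p b′ q d′)) (sym p≡p′) (sym q≡q′) Y-nf
      b≡b′ , d≡d′ = normalForm-col₂ X-nf Y-nf′
  in natMat-≡ p≡p′ b≡b′ q≡q′ d≡d′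

-- The positive expansion

A⁺ℕ-⊗ : ℕ → NatMat → NatMat
A⁺ℕ-⊗ a (natMat p b q d) = natMat (a * p + q) (a * b + d) p b

M⁺ℕ : List ℕ → NatMat
M⁺ℕ []       = natMat 1 0 0 1
M⁺ℕ (a ∷ as) = A⁺ℕ-⊗ a (M⁺ℕ as)

A⁺-⊗-toMat2 : ∀ a X → A⁺ a ⊗ toMat2 X ≡ toMat2 (A⁺ℕ-⊗ a X)
A⁺-⊗-toMat2 a (natMat p b q d) =
  mat-≡ (cong₂ ℤ._+_ (sym (ℤ.pos-* a p)) (ℤ.*-identityˡ (+ q)))
        (cong₂ ℤ._+_ (sym (ℤ.pos-* a b)) (ℤ.*-identityˡ (+ d)))
        (unit-row (+ p) (+ q)) (unit-row (+ b) (+ d))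

M⁺≡toMat2-M⁺ℕ : ∀ as → M⁺ as ≡ toMat2 (M⁺ℕ as)
M⁺≡toMat2-M⁺ℕ []       = refl
M⁺≡toMat2-M⁺ℕ (a ∷ as) = trans (cong (A⁺ a ⊗_) (M⁺≡toMat2-M⁺ℕ as)) (A⁺-⊗-toMat2 a (M⁺ℕ as))

M⁺ℕ-bounds : ∀ {a as} → All (1 ≤_) (a ∷ as) →
             let open NatMat (M⁺ℕ (a ∷ as)) in 1 ≤ b × b ≤ p × d ≤ q
M⁺ℕ-bounds {a} {[]} (1≤a ∷ [])
  rewrite ℕ.*-zeroʳ a | ℕ.*-identityʳ a | ℕ.+-identityʳ a = ℕ.≤-refl , 1≤a , z≤n
M⁺ℕ-bounds {a} {_ ∷ _} (1≤a ∷ as≥1) with M⁺ℕ-bounds as≥1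
... | 1≤b , b≤p , d≤q = ℕ.≤-trans (ℕ.*-mono-≤ 1≤a 1≤b) (ℕ.m≤m+n _ _) ,
                        ℕ.+-mono-≤ (ℕ.*-monoʳ-≤ a b≤p) d≤q ,
                        b≤p

M⁺ℕ-slope : ∀ {as x} → PosCF as x →
            x ℚ.* ι (NatMat.q (M⁺ℕ as)) ≡ ι (NatMat.p (M⁺ℕ as))
M⁺ℕ-slope (one a) =
  trans (ℚ.*-identityʳ (ι a)) (cong ι (sym (trans (ℕ.+-identityʳ (a * 1)) (ℕ.*-identityʳ a))))
M⁺ℕ-slope (cons a {y = y} as-y nz) = +1/-slope y {{nz}} (M⁺ℕ-slope as-y) a

-1^[2*m]≡1 : ∀ m → (ℤ.- 1ℤ) ℤ.^ (2 * m) ≡ 1ℤ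
-1^[2*m]≡1 m = trans (sym (ℤ.^-*-assoc (ℤ.- 1ℤ) 2 m)) (ℤ.^-zeroˡ m)

M⁺ℕ-isNormalForm : ∀ {x} m as → length as ≡ 2 * m → All (1 ≤_) as → PosCF as x →
                   IsNormalForm x (M⁺ℕ as)
M⁺ℕ-isNormalForm m []              _    _            ()
M⁺ℕ-isNormalForm m (_ ∷ [])        odd  _            _    = ⊥-elim (ℕ.even≢odd m 0 (sym odd))
M⁺ℕ-isNormalForm m as@(_ ∷ _ ∷ _) even (_ ∷ tail≥1) as-x =
  let 1≤b , b≤p , _ = M⁺ℕ-bounds tail≥1 in record
  { det≡1 = det-toMat2≡1 (M⁺ℕ as) (begin
      det (toMat2 (M⁺ℕ as))     ≡⟨ cong det (sym (M⁺≡toMat2-M⁺ℕ as)) ⟩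
      det (M⁺ as)               ≡⟨ det-M⁺ as ⟩
      (ℤ.- 1ℤ) ℤ.^ length as    ≡⟨ cong ((ℤ.- 1ℤ) ℤ.^_) even ⟩
      (ℤ.- 1ℤ) ℤ.^ (2 * m)      ≡⟨ -1^[2*m]≡1 m ⟩
      1ℤ                        ∎)
  ; 1≤d   = 1≤b
  ; d≤q   = b≤p
  ; slope = M⁺ℕ-slope as-x
  }
  where open ≡-Reasoning

-- The negative expansion

A⁻-⊗-toMat2 : ∀ c {p b q d p′ b′} → p′ + q ≡ c * p → b′ + d ≡ c * b →
              A⁻ c ⊗ toMat2 (natMat p b q d) ≡ toMat2 (natMat p′ b′ p b)
A⁻-⊗-toMat2 c {p} {b} {q} {d} {p′} {b′} p′+q≡cp b′+d≡cb =
  mat-≡ (minus-row p′ q c p p′+q≡cp) (minus-row b′ d c b b′+d≡cb)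
        (unit-row (+ p) (+ q))        (unit-row (+ b) (+ d))
  where
  minus-row : ∀ m n k l → m + n ≡ k * l → + k ℤ.* + l ℤ.+ ℤ.- + 1 ℤ.* + n ≡ + m
  minus-row m n k l m+n≡kl = begin
    + k ℤ.* + l ℤ.+ ℤ.- + 1 ℤ.* + n   ≡⟨ cong (λ z → z ℤ.+ ℤ.- + 1 ℤ.* + n) (sym (ℤ.pos-* k l)) ⟩
    + (k * l) ℤ.+ ℤ.- + 1 ℤ.* + n     ≡⟨ cong (λ z → + z ℤ.+ ℤ.- + 1 ℤ.* + n) (sym m+n≡kl) ⟩
    + m ℤ.+ + n ℤ.+ ℤ.- + 1 ℤ.* + n   ≡⟨ cancel (+ m) (+ n) ⟩
    + m                               ∎
    where
    open ≡-Reasoning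
    cancel : ∀ x y → x ℤ.+ y ℤ.+ ℤ.- + 1 ℤ.* y ≡ x
    cancel = ℤ-Solver.solve-∀

-- M(c₁,…,c_k) T = ( p b ; q d ) with d = 1 + t, b = d + w, q = s + d and p = (s + v) + b:
-- the slack variables s t v w ∈ ℕ record d ≤ b, d ≤ q and q - d ≤ p - b, an invariant that
-- multiplication by M(c) on the left preserves as long as c ≥ 2.
record Slack : Set where
  constructor slack
  field s t v w : ℕ

slackMat : Slack → NatMat
slackMat (slack s t v w) = natMat ((s + v) + (1 + t + w)) (1 + t + w) (s + (1 + t)) (1 + t)

slackStep : ℕ → Slack → Slack
slackStep k (slack s t v w) = slack (s + v) (t + w) (v + k * (s + v)) (w + k * (1 + t + w))

slackM⁻ : ℕ → List ℕ → Slack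
slackM⁻ c []        = slack 0 0 1 (c ∸ 2)
slackM⁻ c (c′ ∷ cs) = slackStep (c ∸ 2) (slackM⁻ c′ cs)

module _ (k : ℕ) (X : Slack) where
  open Slack X
  open NatMat

  slackStep-p : p (slackMat (slackStep k X)) + q (slackMat X) ≡ (2 + k) * p (slackMat X)
  slackStep-p = identity k s t v w
    where
    identity : ∀ k s t v w →
      (s + v + (v + k * (s + v))) + (1 + (t + w) + (w + k * (1 + t + w))) + (s + (1 + t))
      ≡ (2 + k) * ((s + v) + (1 + t + w))
    identity = ℕ-Solver.solve-∀

  slackStep-b : b (slackMat (slackStep k X)) + d (slackMat X) ≡ (2 + k) * b (slackMat X)
  slackStep-b = identity k t w
    where
    identity : ∀ k t w → (1 + (t + w) + (w + k * (1 + t + w))) + (1 + t) ≡ (2 + k) * (1 + t + w)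
    identity = ℕ-Solver.solve-∀

M⁻⊗T≡slackMat : ∀ {c cs} → All (2 ≤_) (c ∷ cs) → M⁻ (c ∷ cs) ⊗ T ≡ toMat2 (slackMat (slackM⁻ c cs))
M⁻⊗T≡slackMat {c} {[]} (s≤s (s≤s (z≤n {k})) ∷ []) = begin
  (A⁻ c ⊗ I₂) ⊗ T                       ≡⟨ ⊗-assoc (A⁻ c) I₂ T ⟩
  A⁻ c ⊗ toMat2 (natMat 1 1 0 1)        ≡⟨ A⁻-⊗-toMat2 c c+0≡c*1 c-1+1≡c*1 ⟩
  toMat2 (natMat c (suc k) 1 1)         ∎
  where
  open ≡-Reasoning
  c+0≡c*1 : c + 0 ≡ c * 1
  c+0≡c*1 = trans (ℕ.+-identityʳ c) (sym (ℕ.*-identityʳ c))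
  c-1+1≡c*1 : suc k + 1 ≡ c * 1
  c-1+1≡c*1 = trans (ℕ.+-comm (suc k) 1) (sym (ℕ.*-identityʳ c))
M⁻⊗T≡slackMat {c} {c′ ∷ cs} (s≤s (s≤s (z≤n {k})) ∷ cs≥2) = begin
  (A⁻ c ⊗ M⁻ (c′ ∷ cs)) ⊗ T               ≡⟨ ⊗-assoc (A⁻ c) (M⁻ (c′ ∷ cs)) T ⟩
  A⁻ c ⊗ (M⁻ (c′ ∷ cs) ⊗ T)               ≡⟨ cong (A⁻ c ⊗_) (M⁻⊗T≡slackMat cs≥2) ⟩
  A⁻ c ⊗ toMat2 (slackMat X)              ≡⟨ A⁻-⊗-toMat2 c (slackStep-p k X) (slackStep-b k X) ⟩
  toMat2 (slackMat (slackStep k X))       ∎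
  where
  open ≡-Reasoning
  X : Slack
  X = slackM⁻ c′ cs

slackM⁻-slope : ∀ {c cs x} → All (2 ≤_) (c ∷ cs) → NegCF (c ∷ cs) x →
                let open NatMat (slackMat (slackM⁻ c cs)) in x ℚ.* ι q ≡ ι p
slackM⁻-slope (s≤s (s≤s z≤n) ∷ []) (one c) = ℚ.*-identityʳ (ι c)
slackM⁻-slope {cs = c′ ∷ cs} (s≤s (s≤s (z≤n {k})) ∷ cs≥2) (cons c {y = y} cs-y nz) =
  -1/-slope y {{nz}} {p} {q} (slackM⁻-slope cs≥2 cs-y) c p′ (slackStep-p k X)
  where
  X : Slack
  X = slackM⁻ c′ cs
  open NatMat (slackMat X)
  p′ : ℕ
  p′ = NatMat.p (slackMat (slackStep k X))

slackM⁻-isNormalForm : ∀ {c cs x} → All (2 ≤_) (c ∷ cs) → NegCF (c ∷ cs) x →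
                       IsNormalForm x (slackMat (slackM⁻ c cs))
slackM⁻-isNormalForm {c} {cs} cs≥2 cs-x = record
  { det≡1 = det-toMat2≡1 (slackMat (slackM⁻ c cs)) (begin
      det (toMat2 (slackMat (slackM⁻ c cs)))  ≡⟨ cong det (sym (M⁻⊗T≡slackMat cs≥2)) ⟩
      det (M⁻ (c ∷ cs) ⊗ T)                   ≡⟨ det-⊗ (M⁻ (c ∷ cs)) T ⟩
      det (M⁻ (c ∷ cs)) ℤ.* det T             ≡⟨ cong (ℤ._* det T) (det-M⁻ (c ∷ cs)) ⟩
      1ℤ                                      ∎)
  ; 1≤d   = s≤s z≤n
  ; d≤q   = ℕ.m≤n+m _ _
  ; slope = slackM⁻-slope cs≥2 cs-x
  }
  where open ≡-Reasoning

mainTheorem16 : (x : ℚ) → 1ℚ < x →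
    (m : ℕ) (as : List ℕ) → length as ≡ 2 * m → All (1 ≤_) as → PosCF as x →
    (cs : List ℕ) → All (2 ≤_) cs → NegCF cs x →
    M⁺ as ≡ M⁻ cs ⊗ T
mainTheorem16 x _ m as even as≥1 as-x []       _    ()
mainTheorem16 x _ m as even as≥1 as-x (c ∷ cs) cs≥2 cs-x = begin
  M⁺ as                           ≡⟨ M⁺≡toMat2-M⁺ℕ as ⟩
  toMat2 (M⁺ℕ as)                 ≡⟨ cong toMat2 (normalForm-unique
                                       (M⁺ℕ-isNormalForm m as even as≥1 as-x)
                                       (slackM⁻-isNormalForm cs≥2 cs-x)) ⟩
  toMat2 (slackMat (slackM⁻ c cs)) ≡⟨ sym (M⁻⊗T≡slackMat cs≥2) ⟩
  M⁻ (c ∷ cs) ⊗ T                 ∎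
  where open ≡-Reasoning
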